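{- Let $k\ge 0$, let $C_k$ be the chain $x_0<x_1<\dots<x_k$, and let $S=\{y\}$ be the one-element lattice. Then the free product $C_k\ast S$ is the disjoint union of the set of elements $w$ with $w\ge x_0$ and the set of elements $w$ with $w\le y$.
   Context: The free product $A\ast B$ of lattices $A$ and $B$ is the lattice generated by the disjoint union of $A$ and $B$, subject only to the relations holding in $A$ and in $B$; it is the coproduct in the category of lattices. -}

module Defs where

open import Level using (Level; _⊔_)
open import Data.Nat using (ℕ; suc)
open import Data.Fin using (Fin; zero; suc)
open import Data.Unit using (⊤; tt)
open import Relation.Binary.PropositionalEquality using (_≡_)
open import Algebra.Lattice.Bundles.Raw using (RawLattice)

module FreeProduct {a₁ ℓ₁ a₂ ℓ₂ : Level}
                   (A : RawLattice a₁ ℓ₁) (B : RawLattice a₂ ℓ₂) where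
  private
    module A = RawLattice A
    module B = RawLattice B

  infixr 6 _∨_
  infixr 7 _∧_
  data Term : Set (a₁ ⊔ a₂) where
    inl : A.Carrier → Term
    inr : B.Carrier → Term
    _∨_ : Term → Term → Term
    _∧_ : Term → Term → Term

  infix 4 _≈_
  -- The least congruence on terms making the quotient a lattice and
  -- containing the relations of A and of B.  The free product A ∗ B is
  -- Term modulo _≈_.
  data _≈_ : Term → Term → Set (a₁ ⊔ a₂ ⊔ ℓ₁ ⊔ ℓ₂) where
    ≈-refl  : ∀ {s} → s ≈ s
    ≈-sym   : ∀ {s t} → s ≈ t → t ≈ s
    ≈-trans : ∀ {s t u} → s ≈ t → t ≈ u → s ≈ u
    ∨-cong  : ∀ {s s' t t'} → s ≈ s' → t ≈ t' → s ∨ t ≈ s' ∨ t'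
    ∧-cong  : ∀ {s s' t t'} → s ≈ s' → t ≈ t' → s ∧ t ≈ s' ∧ t'
    ∨-comm  : ∀ s t → s ∨ t ≈ t ∨ s
    ∧-comm  : ∀ s t → s ∧ t ≈ t ∧ s
    ∨-assoc : ∀ s t u → (s ∨ t) ∨ u ≈ s ∨ (t ∨ u)
    ∧-assoc : ∀ s t u → (s ∧ t) ∧ u ≈ s ∧ (t ∧ u)
    ∨-absorbs-∧ : ∀ s t → s ∨ (s ∧ t) ≈ s
    ∧-absorbs-∨ : ∀ s t → s ∧ (s ∨ t) ≈ s
    inl-cong : ∀ {x y} → x A.≈ y → inl x ≈ inl y
    inl-∨    : ∀ x y → inl (x A.∨ y) ≈ inl x ∨ inl y
    inl-∧    : ∀ x y → inl (x A.∧ y) ≈ inl x ∧ inl y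
    inr-cong : ∀ {x y} → x B.≈ y → inr x ≈ inr y
    inr-∨    : ∀ x y → inr (x B.∨ y) ≈ inr x ∨ inr y
    inr-∧    : ∀ x y → inr (x B.∧ y) ≈ inr x ∧ inr y

  infix 4 _≤_
  _≤_ : Term → Term → Set (a₁ ⊔ a₂ ⊔ ℓ₁ ⊔ ℓ₂)
  s ≤ t = s ∨ t ≈ t

-- The chain C_k : x_0 < x_1 < ... < x_k, with x_i represented by i : Fin (suc k).
maxF : ∀ {n} → Fin n → Fin n → Fin n
maxF zero j = j
maxF (suc i) zero = suc i
maxF (suc i) (suc j) = suc (maxF i j)

minF : ∀ {n} → Fin n → Fin n → Fin n
minF zero j = zero
minF (suc i) zero = zero
minF (suc i) (suc j) = suc (minF i j)

Chain : ℕ → RawLattice _ _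
Chain k = record
  { Carrier = Fin (suc k) ; _≈_ = _≡_ ; _∨_ = maxF ; _∧_ = minF }

One : RawLattice _ _
One = record { Carrier = ⊤ ; _≈_ = _≡_ ; _∨_ = λ _ _ → tt ; _∧_ = λ _ _ → tt }

{-# OPTIONS --safe #-}
-- Every term lies above inl ⊥ or below inr ⊤, by induction: generators do;
-- a join is above inl ⊥ as soon as one joinand is, and below inr ⊤ when both
-- are; dually for meets.  No term lies in both classes, since inl ⊥ ≰ inr ⊤:
-- the homomorphism onto the two-element lattice sending A to true and B to
-- false separates them.
module Submission where

open import Defs
open import Data.Nat using (ℕ)
open import Data.Fin using (zero)
open import Data.Unit using (tt)
open import Data.Product using (_×_; _,_)
open import Data.Sum using (_⊎_; inj₁; inj₂)
import Data.Sum as Sum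
open import Relation.Nullary using (¬_)
open import Data.Bool using (Bool; true; false)
import Data.Bool as Bool
import Data.Bool.Properties as Bool
open import Relation.Binary.PropositionalEquality as ≡ using (_≡_; refl)
open import Algebra.Lattice.Bundles.Raw using (RawLattice)
open import Algebra.Lattice.Structures using (IsLattice)
open import Algebra.Lattice.Bundles using (Lattice)
import Algebra.Lattice.Properties.Lattice as LatticeProperties
import Relation.Binary.Lattice as Order
import Relation.Binary.Reasoning.Setoid as SetoidReasoning

module _ {a₁ ℓ₁ a₂ ℓ₂} (A : RawLattice a₁ ℓ₁) (B : RawLattice a₂ ℓ₂) where
  open FreeProduct A B
  private
    module A = RawLattice A
    module B = RawLattice B
    module 𝔹 = IsLattice Bool.∨-∧-isLattice

  isLattice : IsLattice _≈_ _∨_ _∧_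
  isLattice = record
    { isEquivalence = record { refl = ≈-refl ; sym = ≈-sym ; trans = ≈-trans }
    ; ∨-comm        = ∨-comm
    ; ∨-assoc       = ∨-assoc
    ; ∨-cong        = ∨-cong
    ; ∧-comm        = ∧-comm
    ; ∧-assoc       = ∧-assoc
    ; ∧-cong        = ∧-cong
    ; absorptive    = ∨-absorbs-∧ , ∧-absorbs-∨
    }

  lattice : Lattice _ _
  lattice = record { isLattice = isLattice }

  -- The library orders an algebraic lattice by s ≈ s ∧ t, whereas FreeProduct._≤_ is s ∨ t ≈ t.
  open Order.Lattice (LatticeProperties.∨-∧-orderTheoreticLattice lattice)
    using (trans; x≤x∨y; y≤x∨y; ∨-least; x∧y≤x; x∧y≤y; ∧-greatest)
    renaming (_≤_ to _⊑_)

  ≤⇒⊑ : ∀ {s t} → s ≤ t → s ⊑ t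
  ≤⇒⊑ {s} {t} s∨t≈t = begin
    s            ≈⟨ ∧-absorbs-∨ s t ⟨
    s ∧ (s ∨ t)  ≈⟨ ∧-cong ≈-refl s∨t≈t ⟩
    s ∧ t        ∎
    where open SetoidReasoning (Lattice.setoid lattice)

  ⊑⇒≤ : ∀ {s t} → s ⊑ t → s ≤ t
  ⊑⇒≤ {s} {t} s≈s∧t = begin
    s ∨ t        ≈⟨ ∨-cong s≈s∧t ≈-refl ⟩
    s ∧ t ∨ t    ≈⟨ ∨-comm (s ∧ t) t ⟩
    t ∨ s ∧ t    ≈⟨ ∨-cong ≈-refl (∧-comm s t) ⟩
    t ∨ t ∧ s    ≈⟨ ∨-absorbs-∧ t s ⟩
    t            ∎
    where open SetoidReasoning (Lattice.setoid lattice)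

  side : Term → Bool
  side (inl _) = true
  side (inr _) = false
  side (s ∨ t) = side s Bool.∨ side t
  side (s ∧ t) = side s Bool.∧ side t

  side-cong : ∀ {s t} → s ≈ t → side s ≡ side t
  side-cong ≈-refl                  = refl
  side-cong (≈-sym p)               = ≡.sym (side-cong p)
  side-cong (≈-trans p q)           = ≡.trans (side-cong p) (side-cong q)
  side-cong (∨-cong p q)            = ≡.cong₂ Bool._∨_ (side-cong p) (side-cong q)
  side-cong (∧-cong p q)            = ≡.cong₂ Bool._∧_ (side-cong p) (side-cong q)
  side-cong (∨-comm s t)            = 𝔹.∨-comm (side s) (side t)
  side-cong (∧-comm s t)            = 𝔹.∧-comm (side s) (side t)
  side-cong (∨-assoc s t u)         = 𝔹.∨-assoc (side s) (side t) (side u)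
  side-cong (∧-assoc s t u)         = 𝔹.∧-assoc (side s) (side t) (side u)
  side-cong (∨-absorbs-∧ s t)       = 𝔹.∨-absorbs-∧ (side s) (side t)
  side-cong (∧-absorbs-∨ s t)       = 𝔹.∧-absorbs-∨ (side s) (side t)
  side-cong (inl-cong _)            = refl
  side-cong (inl-∨ _ _)             = refl
  side-cong (inl-∧ _ _)             = refl
  side-cong (inr-cong _)            = refl
  side-cong (inr-∨ _ _)             = refl
  side-cong (inr-∧ _ _)             = refl

  inl⋢inr : ∀ a b → ¬ (inl a ⊑ inr b)
  inl⋢inr a b inl≈inl∧inr with side-cong inl≈inl∧inr
  ... | ()

  ¬inl≤≤inr : ∀ a b w → ¬ (inl a ≤ w × w ≤ inr b)
  ¬inl≤≤inr a b w (a≤w , w≤b) = inl⋢inr a b (trans (≤⇒⊑ a≤w) (≤⇒⊑ w≤b))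

  module _ {⊥ : A.Carrier} {⊤ : B.Carrier}
           (⊥-least : ∀ x → ⊥ A.∨ x A.≈ x) (⊤-greatest : ∀ y → y B.∨ ⊤ B.≈ ⊤) where

    inl⊥⊑⊎⊑inr⊤ : ∀ w → inl ⊥ ⊑ w ⊎ w ⊑ inr ⊤
    inl⊥⊑⊎⊑inr⊤ (inl x) = inj₁ (≤⇒⊑ (≈-trans (≈-sym (inl-∨ ⊥ x)) (inl-cong (⊥-least x))))
    inl⊥⊑⊎⊑inr⊤ (inr y) = inj₂ (≤⇒⊑ (≈-trans (≈-sym (inr-∨ y ⊤)) (inr-cong (⊤-greatest y))))
    inl⊥⊑⊎⊑inr⊤ (s ∨ t) with inl⊥⊑⊎⊑inr⊤ s | inl⊥⊑⊎⊑inr⊤ t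
    ... | inj₁ ⊥⊑s | _        = inj₁ (trans ⊥⊑s (x≤x∨y s t))
    ... | inj₂ _   | inj₁ ⊥⊑t = inj₁ (trans ⊥⊑t (y≤x∨y s t))
    ... | inj₂ s⊑⊤ | inj₂ t⊑⊤ = inj₂ (∨-least s⊑⊤ t⊑⊤)
    inl⊥⊑⊎⊑inr⊤ (s ∧ t) with inl⊥⊑⊎⊑inr⊤ s | inl⊥⊑⊎⊑inr⊤ t
    ... | inj₂ s⊑⊤ | _        = inj₂ (trans (x∧y≤x s t) s⊑⊤)
    ... | inj₁ _   | inj₂ t⊑⊤ = inj₂ (trans (x∧y≤y s t) t⊑⊤)
    ... | inj₁ ⊥⊑s | inj₁ ⊥⊑t = inj₁ (∧-greatest ⊥⊑s ⊥⊑t)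

    inl⊥≤⊎≤inr⊤ : ∀ w → inl ⊥ ≤ w ⊎ w ≤ inr ⊤
    inl⊥≤⊎≤inr⊤ w = Sum.map ⊑⇒≤ ⊑⇒≤ (inl⊥⊑⊎⊑inr⊤ w)

lemma2 : (k : ℕ) → let open FreeProduct (Chain k) One in
    ∀ (w : Term) → (inl zero ≤ w ⊎ w ≤ inr tt) × ¬ (inl zero ≤ w × w ≤ inr tt)
lemma2 k w =
  inl⊥≤⊎≤inr⊤ (Chain k) One (λ _ → refl) (λ _ → refl) w ,
  ¬inl≤≤inr (Chain k) One zero tt w
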